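{- Let $R$ be a discrete valuation ring with uniformizer $\pi$ and valuation $v$ in which $2$ is a unit, let $f(x)=x^2-ax-b\in R[x]$ be irreducible, and put $\Delta=\frac{a^2}{4}+b$. Then every $A\in\mathrm{Mat}_2(R)$ with characteristic polynomial $f$ is similar over $R$ to exactly one of the matrices \[\begin{pmatrix}\frac a2&\pi^k\\ \Delta\pi^{ -k}&\frac a2\end{pmatrix},\qquad k\in\mathbb{Z},\ 0\le 2k\le v(\Delta).\]
   Context: Similar over $R$ means conjugate by an element of $\mathrm{GL}_2(R)$. -}

module Defs where

open import Level using (_⊔_)
open import Algebra.Bundles using (CommutativeRing)
open import Data.Nat using (ℕ; zero; suc; _≤_; _*_)
open import Data.Product using (Σ; ∃; ∃-syntax; _×_; _,_)
open import Data.Sum using (_⊎_)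
open import Relation.Nullary using (¬_)

module _ {c ℓ} (R : CommutativeRing c ℓ) where
  open CommutativeRing R renaming (_*_ to _·_)

  pow : Carrier → ℕ → Carrier
  pow x zero    = 1#
  pow x (suc n) = x · pow x n

  IsUnit : Carrier → Set (c ⊔ ℓ)
  IsUnit x = ∃[ y ] (x · y ≈ 1#)

  record IsDomain : Set (c ⊔ ℓ) where
    field
      1≉0        : ¬ (1# ≈ 0#)
      noZeroDiv  : ∀ x y → x · y ≈ 0# → (x ≈ 0#) ⊎ (y ≈ 0#)

  -- A discrete valuation ring: an integral domain with a uniformizer π
  -- (nonzero non-unit) such that every nonzero x is uniquely u·π^n with
  -- u a unit; v x is this exponent n (the normalized valuation).  v 0 is
  -- an arbitrary natural number (v(0)=∞ is never used).
  record IsDVR : Set (c ⊔ ℓ) where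
    field
      isDomain   : IsDomain
      π          : Carrier
      π≉0        : ¬ (π ≈ 0#)
      π-nonunit  : ¬ IsUnit π
      v          : Carrier → ℕ
      v-spec     : ∀ x → ¬ (x ≈ 0#) → ∃[ u ] (IsUnit u × x ≈ u · pow π (v x))

  -- Irreducibility of the monic quadratic f = x² - a x - b in R[x], for
  -- R a domain.  Any factorisation f = g·h in R[x] has deg g + deg h = 2,
  -- so f is reducible iff f = (c x + d)(e x + g) with both factors of
  -- degree 1 (i.e. c·e = 1), or f = c · h with c a non-unit constant and
  -- h = p x² + q x + r.
  Reducible₂ : Carrier → Carrier → Set (c ⊔ ℓ)
  Reducible₂ a b =
      (∃[ c₁ ] ∃[ d ] ∃[ e ] ∃[ g ]
         (c₁ · e ≈ 1# × c₁ · g + d · e ≈ - a × d · g ≈ - b))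
    ⊎ (∃[ c₀ ] ∃[ p ] ∃[ q ] ∃[ r ]
         (¬ IsUnit c₀ × c₀ · p ≈ 1# × c₀ · q ≈ - a × c₀ · r ≈ - b))

  Irreducible₂ : Carrier → Carrier → Set (c ⊔ ℓ)
  Irreducible₂ a b = ¬ Reducible₂ a b

  record Mat2 : Set c where
    constructor mat
    field
      m11 m12 m21 m22 : Carrier
  open Mat2 public

  _≈M_ : Mat2 → Mat2 → Set ℓ
  A ≈M B = (m11 A ≈ m11 B) × (m12 A ≈ m12 B) × (m21 A ≈ m21 B) × (m22 A ≈ m22 B)

  _⊗_ : Mat2 → Mat2 → Mat2
  A ⊗ B = mat (m11 A · m11 B + m12 A · m21 B) (m11 A · m12 B + m12 A · m22 B)
              (m21 A · m11 B + m22 A · m21 B) (m21 A · m12 B + m22 A · m22 B)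

  I₂ : Mat2
  I₂ = mat 1# 0# 0# 1#

  -- characteristic polynomial of A equals x² - a x - b:
  -- det(xI - A) = x² - tr(A) x + det(A)
  HasCharPoly : Mat2 → Carrier → Carrier → Set ℓ
  HasCharPoly A a b =
    (m11 A + m22 A ≈ a) × (m11 A · m22 A - m12 A · m21 A ≈ - b)

  Similar : Mat2 → Mat2 → Set (c ⊔ ℓ)
  Similar A B = ∃[ P ] ∃[ Q ]
    ((P ⊗ Q) ≈M I₂ × (Q ⊗ P) ≈M I₂ × ((P ⊗ A) ⊗ Q) ≈M B)

  -- The normal form  ( a/2   π^k ; Δ π^{-k}  a/2 ), where the entry
  -- Δπ^{-k} is passed as an element y with y · π^k = Δ (it is unique,
  -- R being a domain and π ≠ 0).
  NF : Carrier → Carrier → Carrier → ℕ → Carrier → Mat2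
  NF half a π k y = mat (a · half) (pow π k) y (a · half)

{-# OPTIONS --safe #-}
module Submission where

-- Put s = a/2. A matrix with characteristic polynomial f is A = s·I + N with N traceless and
-- -det N = Δ, where Δ ≠ 0 because f is irreducible. Let k be the largest exponent with
-- A ≡ s·I (mod π^k); it is a similarity invariant, and writing N = π^k N′ gives
-- Δ = π^(2k)·(-det N′), so 2k ≤ v(Δ). As N′ is primitive and 2 is a unit, some vector w makes
-- (N′w, w) a basis of R²; since N′² = (Δπ^(-2k))·I, in this basis N′ acts by the companion
-- matrix of x² - Δπ^(-2k), and A becomes the normal form with index k. Conversely the normal
-- form with index k′ is ≡ s·I (mod π^k′) but not mod π^(k′+1), because of its entry π^k′;
-- so k′ = k, and then its remaining entry Δπ^(-k) is determined.

open import Algebra.Bundles using (CommutativeRing)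
open import Data.Empty using (⊥-elim)
open import Data.Integer as ℤ using (ℤ; +_; -[1+_]; sign)
import Data.Integer.Properties as ℤ
open import Data.Maybe using (Maybe; map)
open import Data.Nat as ℕ using (ℕ; zero; suc; _≤_; _*_)
import Data.Nat.Properties as ℕ
open import Data.Product using (∃-syntax; _×_; _,_)
open import Data.Sign as Sign using (Sign)
open import Data.Sum as Sum using (_⊎_; inj₁; inj₂; [_,_]′)
open import Function using (_∘_; id)
open import Function.Bundles using (_⇔_; mk⇔; Equivalence)
open import Level using (_⊔_)
open import Relation.Binary.Bundles using (Setoid)
open import Relation.Binary.Consequences using (dec⇒weaklyDec)
open import Relation.Binary.PropositionalEquality as ≡ using (_≡_)
open import Relation.Nullary using (¬_; Dec; yes; no)
import Relation.Nullary.Decidable as Dec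
open import Relation.Nullary.Decidable using (_×-dec_)

open import Defs

-- The ring solver needs a coefficient ring with decidable equality mapping into R: ℤ is one.
module IntegerCoefficientSolver {c ℓ} (R : CommutativeRing c ℓ) where
  open CommutativeRing R renaming (_*_ to _·_)
  open import Algebra.Properties.Ring ring
    using (-0#≈0#; -‿involutive; -‿distribˡ-*; -‿distribʳ-*; -‿+-comm)
  open import Algebra.Properties.Semiring.Mult.TCOptimised semiring
    using (×-homo-+; ×1-homo-*; 1+×) renaming (_×_ to _×ₙ_)
  open import Algebra.Solver.Ring.AlmostCommutativeRing
    using (_-Raw-AlmostCommutative⟶_; fromCommutativeRing)
  open import Relation.Binary.Reasoning.Setoid setoid

  private
    signed : Sign → Carrier → Carrier
    signed Sign.+ x = x
    signed Sign.- x = - x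

    ⟦_⟧ : ℤ → Carrier
    ⟦ i ⟧ = signed (sign i) (ℤ.∣ i ∣ ×ₙ 1#)

    signed-cong : ∀ s {x y} → x ≈ y → signed s x ≈ signed s y
    signed-cong Sign.+ x≈y = x≈y
    signed-cong Sign.- x≈y = -‿cong x≈y

    signed-· : ∀ s t x y → signed (s Sign.* t) (x · y) ≈ signed s x · signed t y
    signed-· Sign.+ Sign.+ x y = refl
    signed-· Sign.+ Sign.- x y = -‿distribʳ-* x y
    signed-· Sign.- Sign.+ x y = -‿distribˡ-* x y
    signed-· Sign.- Sign.- x y = begin
      x · y          ≈⟨ -‿involutive (x · y) ⟨
      - - (x · y)    ≈⟨ -‿cong (-‿distribˡ-* x y) ⟩
      - (- x · y)    ≈⟨ -‿distribʳ-* (- x) y ⟩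
      - x · - y      ∎

    ◃-homo : ∀ s n → ⟦ s ℤ.◃ n ⟧ ≈ signed s (n ×ₙ 1#)
    ◃-homo Sign.+ zero    = refl
    ◃-homo Sign.- zero    = sym -0#≈0#
    ◃-homo Sign.+ (suc n) = refl
    ◃-homo Sign.- (suc n) = refl

    ⊖-homo : ∀ m n → ⟦ m ℤ.⊖ n ⟧ ≈ m ×ₙ 1# - n ×ₙ 1#
    ⊖-homo zero    zero    = sym (trans (+-congˡ -0#≈0#) (+-identityʳ 0#))
    ⊖-homo zero    (suc n) = sym (+-identityˡ _)
    ⊖-homo (suc m) zero    = sym (trans (+-congˡ -0#≈0#) (+-identityʳ _))
    ⊖-homo (suc m) (suc n) = begin
      ⟦ suc m ℤ.⊖ suc n ⟧              ≡⟨ ≡.cong ⟦_⟧ (ℤ.[1+m]⊖[1+n]≡m⊖n m n) ⟩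
      ⟦ m ℤ.⊖ n ⟧                      ≈⟨ ⊖-homo m n ⟩
      m ×ₙ 1# - n ×ₙ 1#                ≈⟨ 1+-1+-cancel (m ×ₙ 1#) (n ×ₙ 1#) ⟨
      (1# + m ×ₙ 1#) - (1# + n ×ₙ 1#)  ≈⟨ +-cong (1+× m 1#) (-‿cong (1+× n 1#)) ⟨
      suc m ×ₙ 1# - suc n ×ₙ 1#        ∎
      where
      1+-1+-cancel : ∀ x y → (1# + x) - (1# + y) ≈ x - y
      1+-1+-cancel x y = begin
        (1# + x) - (1# + y)      ≈⟨ +-cong (+-comm x 1#) (-‿+-comm 1# y) ⟨
        (x + 1#) + (- 1# - y)    ≈⟨ +-assoc x 1# _ ⟩
        x + (1# + (- 1# - y))    ≈⟨ +-congˡ (+-assoc 1# (- 1#) _) ⟨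
        x + ((1# - 1#) - y)      ≈⟨ +-congˡ (+-congʳ (-‿inverseʳ 1#)) ⟩
        x + (0# - y)             ≈⟨ +-congˡ (+-identityˡ _) ⟩
        x - y                    ∎

    +-homo : ∀ i j → ⟦ i ℤ.+ j ⟧ ≈ ⟦ i ⟧ + ⟦ j ⟧
    +-homo (+ m)    (+ n)    = ×-homo-+ 1# m n
    +-homo (+ m)    -[1+ n ] = ⊖-homo m (suc n)
    +-homo -[1+ m ] (+ n)    = trans (⊖-homo n (suc m)) (+-comm _ _)
    +-homo -[1+ m ] -[1+ n ] = begin
      - (suc (suc (m ℕ.+ n)) ×ₙ 1#)      ≡⟨ ≡.cong (λ k → - (suc k ×ₙ 1#)) (ℕ.+-suc m n) ⟨
      - ((suc m ℕ.+ suc n) ×ₙ 1#)        ≈⟨ -‿cong (×-homo-+ 1# (suc m) (suc n)) ⟩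
      - (suc m ×ₙ 1# + suc n ×ₙ 1#)      ≈⟨ -‿+-comm _ _ ⟨
      - (suc m ×ₙ 1#) + - (suc n ×ₙ 1#)  ∎

    *-homo : ∀ i j → ⟦ i ℤ.* j ⟧ ≈ ⟦ i ⟧ · ⟦ j ⟧
    *-homo i j = begin
      ⟦ σ ℤ.◃ (∣i∣ ℕ.* ∣j∣) ⟧           ≈⟨ ◃-homo σ (∣i∣ ℕ.* ∣j∣) ⟩
      signed σ ((∣i∣ ℕ.* ∣j∣) ×ₙ 1#)    ≈⟨ signed-cong σ (×1-homo-* ∣i∣ ∣j∣) ⟩
      signed σ (∣i∣ ×ₙ 1# · ∣j∣ ×ₙ 1#)  ≈⟨ signed-· (sign i) (sign j) _ _ ⟩
      ⟦ i ⟧ · ⟦ j ⟧                     ∎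
      where
      σ : Sign
      σ = sign i Sign.* sign j
      ∣i∣ ∣j∣ : ℕ
      ∣i∣ = ℤ.∣ i ∣
      ∣j∣ = ℤ.∣ j ∣

    -‿homo : ∀ i → ⟦ ℤ.- i ⟧ ≈ - ⟦ i ⟧
    -‿homo (+ zero)  = sym -0#≈0#
    -‿homo (+ suc n) = refl
    -‿homo -[1+ n ]  = sym (-‿involutive _)

    homomorphism : ℤ.+-*-rawRing -Raw-AlmostCommutative⟶ fromCommutativeRing R
    homomorphism = record
      { ⟦_⟧ = ⟦_⟧ ; +-homo = +-homo ; *-homo = *-homo ; -‿homo = -‿homo
      ; 0-homo = refl ; 1-homo = refl }

    ⟦⟧-≟ : ∀ i j → Maybe (⟦ i ⟧ ≈ ⟦ j ⟧)
    ⟦⟧-≟ i j = map (λ { ≡.refl → refl }) (dec⇒weaklyDec ℤ._≟_ i j)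

  open import Algebra.Solver.Ring ℤ.+-*-rawRing (fromCommutativeRing R) homomorphism ⟦⟧-≟
    public using (solve; _:=_; _:+_; _:*_; :-_; _:-_; con)

∃-boundary : ∀ {p} {P : ℕ → Set p} → (∀ n → Dec (P n)) → P 0 → ∀ n → ¬ P n → ∃[ k ] (P k × ¬ P (suc k))
∃-boundary P? P0 zero    ¬Pn = ⊥-elim (¬Pn P0)
∃-boundary P? P0 (suc n) ¬Pn+1 with P? n
... | yes Pn = n , Pn , ¬Pn+1
... | no ¬Pn = ∃-boundary P? P0 n ¬Pn

module Matrix {c ℓ} (R : CommutativeRing c ℓ) where
  open CommutativeRing R renaming (_*_ to _·_)
  open IntegerCoefficientSolver R
  open import Algebra.Properties.Semiring.Divisibility semiring using (_∣_; _,_)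

  infix  4 _≋_
  infixl 6 _⊕_
  infixl 7 _∙_ _⊙_

  _≋_ : Mat2 R → Mat2 R → Set ℓ
  _≋_ = _≈M_ R

  _∙_ : Mat2 R → Mat2 R → Mat2 R
  _∙_ = _⊗_ R

  I : Mat2 R
  I = I₂ R

  _⊕_ : Mat2 R → Mat2 R → Mat2 R
  A ⊕ B = mat (m11 A + m11 B) (m12 A + m12 B) (m21 A + m21 B) (m22 A + m22 B)

  _⊙_ : Carrier → Mat2 R → Mat2 R
  t ⊙ A = mat (t · m11 A) (t · m12 A) (t · m21 A) (t · m22 A)

  ≋-setoid : Setoid c ℓ
  ≋-setoid = record
    { Carrier = Mat2 R
    ; _≈_ = _≋_
    ; isEquivalence = record
      { refl  = refl , refl , refl , refl
      ; sym   = λ (e₁₁ , e₁₂ , e₂₁ , e₂₂) → sym e₁₁ , sym e₁₂ , sym e₂₁ , sym e₂₂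
      ; trans = λ (e₁₁ , e₁₂ , e₂₁ , e₂₂) (f₁₁ , f₁₂ , f₂₁ , f₂₂) →
                  trans e₁₁ f₁₁ , trans e₁₂ f₁₂ , trans e₂₁ f₂₁ , trans e₂₂ f₂₂
      }
    }

  open Setoid ≋-setoid public using () renaming (refl to ≋-refl; trans to ≋-trans)
  open import Relation.Binary.Reasoning.Setoid ≋-setoid

  ∙-cong : ∀ {A A′ B B′} → A ≋ A′ → B ≋ B′ → A ∙ B ≋ A′ ∙ B′
  ∙-cong (a₁₁ , a₁₂ , a₂₁ , a₂₂) (b₁₁ , b₁₂ , b₂₁ , b₂₂) =
    +-cong (*-cong a₁₁ b₁₁) (*-cong a₁₂ b₂₁) , +-cong (*-cong a₁₁ b₁₂) (*-cong a₁₂ b₂₂) ,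
    +-cong (*-cong a₂₁ b₁₁) (*-cong a₂₂ b₂₁) , +-cong (*-cong a₂₁ b₁₂) (*-cong a₂₂ b₂₂)

  ⊕-cong : ∀ {A A′ B B′} → A ≋ A′ → B ≋ B′ → A ⊕ B ≋ A′ ⊕ B′
  ⊕-cong (a₁₁ , a₁₂ , a₂₁ , a₂₂) (b₁₁ , b₁₂ , b₂₁ , b₂₂) =
    +-cong a₁₁ b₁₁ , +-cong a₁₂ b₁₂ , +-cong a₂₁ b₂₁ , +-cong a₂₂ b₂₂

  ⊙-congˡ : ∀ {s t} A → s ≈ t → s ⊙ A ≋ t ⊙ A
  ⊙-congˡ A s≈t = *-congʳ s≈t , *-congʳ s≈t , *-congʳ s≈t , *-congʳ s≈t

  ⊙-congʳ : ∀ t {A B} → A ≋ B → t ⊙ A ≋ t ⊙ B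
  ⊙-congʳ t (e₁₁ , e₁₂ , e₂₁ , e₂₂) = *-congˡ e₁₁ , *-congˡ e₁₂ , *-congˡ e₂₁ , *-congˡ e₂₂

  ⊙-assoc : ∀ s t A → (s · t) ⊙ A ≋ s ⊙ (t ⊙ A)
  ⊙-assoc s t A = *-assoc s t _ , *-assoc s t _ , *-assoc s t _ , *-assoc s t _

  private
    assoc-entry : ∀ a₁ a₂ b₁₁ b₁₂ b₂₁ b₂₂ c₁ c₂ →
      (a₁ · b₁₁ + a₂ · b₂₁) · c₁ + (a₁ · b₁₂ + a₂ · b₂₂) · c₂
        ≈ a₁ · (b₁₁ · c₁ + b₁₂ · c₂) + a₂ · (b₂₁ · c₁ + b₂₂ · c₂)
    assoc-entry = solve 8 (λ a₁ a₂ b₁₁ b₁₂ b₂₁ b₂₂ c₁ c₂ →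
      (a₁ :* b₁₁ :+ a₂ :* b₂₁) :* c₁ :+ (a₁ :* b₁₂ :+ a₂ :* b₂₂) :* c₂
        := a₁ :* (b₁₁ :* c₁ :+ b₁₂ :* c₂) :+ a₂ :* (b₂₁ :* c₁ :+ b₂₂ :* c₂)) refl

  ∙-assoc : ∀ A B C → (A ∙ B) ∙ C ≋ A ∙ (B ∙ C)
  ∙-assoc (mat a₁₁ a₁₂ a₂₁ a₂₂) (mat b₁₁ b₁₂ b₂₁ b₂₂) (mat c₁₁ c₁₂ c₂₁ c₂₂) =
    assoc-entry a₁₁ a₁₂ b₁₁ b₁₂ b₂₁ b₂₂ c₁₁ c₂₁ , assoc-entry a₁₁ a₁₂ b₁₁ b₁₂ b₂₁ b₂₂ c₁₂ c₂₂ ,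
    assoc-entry a₂₁ a₂₂ b₁₁ b₁₂ b₂₁ b₂₂ c₁₁ c₂₁ , assoc-entry a₂₁ a₂₂ b₁₁ b₁₂ b₂₁ b₂₂ c₁₂ c₂₂

  ∙-identityˡ : ∀ A → I ∙ A ≋ A
  ∙-identityˡ (mat a₁₁ a₁₂ a₂₁ a₂₂) = 1x+0y≈x a₁₁ a₂₁ , 1x+0y≈x a₁₂ a₂₂ , 0x+1y≈y a₁₁ a₂₁ , 0x+1y≈y a₁₂ a₂₂
    where
    1x+0y≈x : ∀ x y → 1# · x + 0# · y ≈ x
    1x+0y≈x = solve 2 (λ x y → con (+ 1) :* x :+ con (+ 0) :* y := x) refl
    0x+1y≈y : ∀ x y → 0# · x + 1# · y ≈ y
    0x+1y≈y = solve 2 (λ x y → con (+ 0) :* x :+ con (+ 1) :* y := y) refl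

  ∙-identityʳ : ∀ A → A ∙ I ≋ A
  ∙-identityʳ (mat a₁₁ a₁₂ a₂₁ a₂₂) = x1+y0≈x a₁₁ a₁₂ , x0+y1≈y a₁₁ a₁₂ , x1+y0≈x a₂₁ a₂₂ , x0+y1≈y a₂₁ a₂₂
    where
    x1+y0≈x : ∀ x y → x · 1# + y · 0# ≈ x
    x1+y0≈x = solve 2 (λ x y → x :* con (+ 1) :+ y :* con (+ 0) := x) refl
    x0+y1≈y : ∀ x y → x · 0# + y · 1# ≈ y
    x0+y1≈y = solve 2 (λ x y → x :* con (+ 0) :+ y :* con (+ 1) := y) refl

  similar-sym : ∀ {A B} → Similar R A B → Similar R B A
  similar-sym {A} {B} (P , Q , PQ≋I , QP≋I , PAQ≋B) = Q , P , QP≋I , PQ≋I , (begin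
    (Q ∙ B) ∙ P              ≈⟨ ∙-cong (∙-cong ≋-refl PAQ≋B) ≋-refl ⟨
    (Q ∙ ((P ∙ A) ∙ Q)) ∙ P  ≈⟨ ∙-cong (∙-cong ≋-refl (∙-assoc P A Q)) ≋-refl ⟩
    (Q ∙ (P ∙ (A ∙ Q))) ∙ P  ≈⟨ ∙-cong (∙-assoc Q P (A ∙ Q)) ≋-refl ⟨
    ((Q ∙ P) ∙ (A ∙ Q)) ∙ P  ≈⟨ ∙-cong (∙-cong QP≋I ≋-refl) ≋-refl ⟩
    (I ∙ (A ∙ Q)) ∙ P        ≈⟨ ∙-cong (∙-identityˡ (A ∙ Q)) ≋-refl ⟩
    (A ∙ Q) ∙ P              ≈⟨ ∙-assoc A Q P ⟩
    A ∙ (Q ∙ P)              ≈⟨ ∙-cong ≋-refl QP≋I ⟩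
    A ∙ I                    ≈⟨ ∙-identityʳ A ⟩
    A                        ∎)

  similar-resp-≋ : ∀ {A A′ B B′} → A ≋ A′ → B′ ≋ B → Similar R A′ B′ → Similar R A B
  similar-resp-≋ A≋A′ B′≋B (P , Q , PQ≋I , QP≋I , PA′Q≋B′) =
    P , Q , PQ≋I , QP≋I , ≋-trans (∙-cong (∙-cong ≋-refl A≋A′) ≋-refl) (≋-trans PA′Q≋B′ B′≋B)

  private
    conj-affine-entry : ∀ p₁ p₂ q₁ q₂ s t z₁₁ z₁₂ z₂₁ z₂₂ →
      (p₁ · (s · 1# + t · z₁₁) + p₂ · (s · 0# + t · z₂₁)) · q₁
        + (p₁ · (s · 0# + t · z₁₂) + p₂ · (s · 1# + t · z₂₂)) · q₂
      ≈ s · (p₁ · q₁ + p₂ · q₂)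
        + t · ((p₁ · z₁₁ + p₂ · z₂₁) · q₁ + (p₁ · z₁₂ + p₂ · z₂₂) · q₂)
    conj-affine-entry = solve 10 (λ p₁ p₂ q₁ q₂ s t z₁₁ z₁₂ z₂₁ z₂₂ →
      (p₁ :* (s :* con (+ 1) :+ t :* z₁₁) :+ p₂ :* (s :* con (+ 0) :+ t :* z₂₁)) :* q₁
        :+ (p₁ :* (s :* con (+ 0) :+ t :* z₁₂) :+ p₂ :* (s :* con (+ 1) :+ t :* z₂₂)) :* q₂
      := s :* (p₁ :* q₁ :+ p₂ :* q₂)
        :+ t :* ((p₁ :* z₁₁ :+ p₂ :* z₂₁) :* q₁ :+ (p₁ :* z₁₂ :+ p₂ :* z₂₂) :* q₂)) refl

  ∙-conj-affine : ∀ P Q s t Z →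
    (P ∙ (s ⊙ I ⊕ t ⊙ Z)) ∙ Q ≋ s ⊙ (P ∙ Q) ⊕ t ⊙ ((P ∙ Z) ∙ Q)
  ∙-conj-affine (mat p₁₁ p₁₂ p₂₁ p₂₂) (mat q₁₁ q₁₂ q₂₁ q₂₂) s t (mat z₁₁ z₁₂ z₂₁ z₂₂) =
    conj-affine-entry p₁₁ p₁₂ q₁₁ q₂₁ s t z₁₁ z₁₂ z₂₁ z₂₂ ,
    conj-affine-entry p₁₁ p₁₂ q₁₂ q₂₂ s t z₁₁ z₁₂ z₂₁ z₂₂ ,
    conj-affine-entry p₂₁ p₂₂ q₁₁ q₂₁ s t z₁₁ z₁₂ z₂₁ z₂₂ ,
    conj-affine-entry p₂₁ p₂₂ q₁₂ q₂₂ s t z₁₁ z₁₂ z₂₁ z₂₂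

  similar-affine : ∀ {P Q X Y} s t → P ∙ Q ≋ I → Q ∙ P ≋ I → X ∙ Q ≋ Q ∙ Y →
    Similar R (s ⊙ I ⊕ t ⊙ X) (s ⊙ I ⊕ t ⊙ Y)
  similar-affine {P} {Q} {X} {Y} s t PQ≋I QP≋I XQ≋QY = P , Q , PQ≋I , QP≋I , (begin
    (P ∙ (s ⊙ I ⊕ t ⊙ X)) ∙ Q        ≈⟨ ∙-conj-affine P Q s t X ⟩
    s ⊙ (P ∙ Q) ⊕ t ⊙ ((P ∙ X) ∙ Q)  ≈⟨ ⊕-cong (⊙-congʳ s PQ≋I) (⊙-congʳ t PXQ≋Y) ⟩
    s ⊙ I ⊕ t ⊙ Y                    ∎)
    where
    PXQ≋Y : (P ∙ X) ∙ Q ≋ Y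
    PXQ≋Y = begin
      (P ∙ X) ∙ Q  ≈⟨ ∙-assoc P X Q ⟩
      P ∙ (X ∙ Q)  ≈⟨ ∙-cong ≋-refl XQ≋QY ⟩
      P ∙ (Q ∙ Y)  ≈⟨ ∙-assoc P Q Y ⟨
      (P ∙ Q) ∙ Y  ≈⟨ ∙-cong PQ≋I ≋-refl ⟩
      I ∙ Y        ≈⟨ ∙-identityˡ Y ⟩
      Y            ∎

  det : Mat2 R → Carrier
  det A = m11 A · m22 A - m12 A · m21 A

  adj : Mat2 R → Mat2 R
  adj A = mat (m22 A) (- m12 A) (- m21 A) (m11 A)

  adj-inverse : ∀ A {e} → det A · e ≈ 1# → (e ⊙ adj A) ∙ A ≋ I × A ∙ (e ⊙ adj A) ≋ I
  adj-inverse (mat a b c d) {e} det·e≈1 =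
    (via-det (solve 5 (λ a b c d e → e :* d :* a :+ e :* (:- b) :* c := (a :* d :- b :* c) :* e)
                      refl a b c d e) ,
     solve 5 (λ a b c d e → e :* d :* b :+ e :* (:- b) :* d := con (+ 0)) refl a b c d e ,
     solve 5 (λ a b c d e → e :* (:- c) :* a :+ e :* a :* c := con (+ 0)) refl a b c d e ,
     via-det (solve 5 (λ a b c d e → e :* (:- c) :* b :+ e :* a :* d := (a :* d :- b :* c) :* e)
                      refl a b c d e)) ,
    (via-det (solve 5 (λ a b c d e → a :* (e :* d) :+ b :* (e :* (:- c)) := (a :* d :- b :* c) :* e)
                      refl a b c d e) ,
     solve 5 (λ a b c d e → a :* (e :* (:- b)) :+ b :* (e :* a) := con (+ 0)) refl a b c d e ,
     solve 5 (λ a b c d e → c :* (e :* d) :+ d :* (e :* (:- c)) := con (+ 0)) refl a b c d e ,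
     via-det (solve 5 (λ a b c d e → c :* (e :* (:- b)) :+ d :* (e :* a) := (a :* d :- b :* c) :* e)
                      refl a b c d e))
    where
    via-det : ∀ {x} → x ≈ (a · d - b · c) · e → x ≈ 1#
    via-det x≈det·e = trans x≈det·e det·e≈1

  traceless : Carrier → Carrier → Carrier → Mat2 R
  traceless p q r = mat p q r (- p)

  companion : Carrier → Mat2 R
  companion d = mat 0# 1# d 0#

  -- The basis (N w, w) for N = traceless p q r and w = (α, β); since N ∙ N = (p · p + q · r) ⊙ I,
  -- N acts on it by the companion matrix of x² - (p · p + q · r).
  cyclicBasis : Carrier → Carrier → Carrier → Carrier → Carrier → Mat2 R
  cyclicBasis p q r α β = mat (p · α + q · β) α (r · α - p · β) β

  traceless-∙-cyclicBasis : ∀ p q r α β →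
    traceless p q r ∙ cyclicBasis p q r α β ≋ cyclicBasis p q r α β ∙ companion (p · p + q · r)
  traceless-∙-cyclicBasis p q r α β =
    solve 5 (λ p q r α β → p :* (p :* α :+ q :* β) :+ q :* (r :* α :- p :* β)
                         := (p :* α :+ q :* β) :* con (+ 0) :+ α :* (p :* p :+ q :* r)) refl p q r α β ,
    solve 5 (λ p q r α β → p :* α :+ q :* β
                         := (p :* α :+ q :* β) :* con (+ 1) :+ α :* con (+ 0)) refl p q r α β ,
    solve 5 (λ p q r α β → r :* (p :* α :+ q :* β) :+ (:- p) :* (r :* α :- p :* β)
                         := (r :* α :- p :* β) :* con (+ 0) :+ β :* (p :* p :+ q :* r)) refl p q r α β ,
    solve 5 (λ p q r α β → r :* α :+ (:- p) :* β
                         := (r :* α :- p :* β) :* con (+ 1) :+ β :* con (+ 0)) refl p q r α β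

  affine-companion : ∀ s t d → s ⊙ I ⊕ t ⊙ companion d ≋ mat s t (t · d) s
  affine-companion s t d =
    solve 2 (λ s t → s :* con (+ 1) :+ t :* con (+ 0) := s) refl s t ,
    solve 2 (λ s t → s :* con (+ 0) :+ t :* con (+ 1) := t) refl s t ,
    solve 3 (λ s t d → s :* con (+ 0) :+ t :* d := t :* d) refl s t d ,
    solve 2 (λ s t → s :* con (+ 1) :+ t :* con (+ 0) := s) refl s t

  similar-companion : ∀ {p q r α β e} s t → det (cyclicBasis p q r α β) · e ≈ 1# →
    Similar R (s ⊙ I ⊕ t ⊙ traceless p q r) (s ⊙ I ⊕ t ⊙ companion (p · p + q · r))
  similar-companion {p} {q} {r} {α} {β} s t det·e≈1 =
    let (Q⁻¹Q≋I , QQ⁻¹≋I) = adj-inverse (cyclicBasis p q r α β) det·e≈1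
    in similar-affine s t Q⁻¹Q≋I QQ⁻¹≋I (traceless-∙-cyclicBasis p q r α β)

  infix 4 _≡_·I[mod_]
  _≡_·I[mod_] : Mat2 R → Carrier → Carrier → Set (c ⊔ ℓ)
  A ≡ s ·I[mod t ] = ∃[ Z ] A ≋ s ⊙ I ⊕ t ⊙ Z

  ≡·I[mod]-similar : ∀ {A B s t} → Similar R A B → A ≡ s ·I[mod t ] → B ≡ s ·I[mod t ]
  ≡·I[mod]-similar {A} {B} {s} {t} (P , Q , PQ≋I , _ , PAQ≋B) (Z , A≋) = (P ∙ Z) ∙ Q , (begin
    B                                ≈⟨ PAQ≋B ⟨
    (P ∙ A) ∙ Q                      ≈⟨ ∙-cong (∙-cong ≋-refl A≋) ≋-refl ⟩
    (P ∙ (s ⊙ I ⊕ t ⊙ Z)) ∙ Q        ≈⟨ ∙-conj-affine P Q s t Z ⟩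
    s ⊙ (P ∙ Q) ⊕ t ⊙ ((P ∙ Z) ∙ Q)  ≈⟨ ⊕-cong (⊙-congʳ s PQ≋I) ≋-refl ⟩
    s ⊙ I ⊕ t ⊙ ((P ∙ Z) ∙ Q)        ∎)

  ≡·I[mod]-∣ : ∀ {A s t t′} → t ∣ t′ → A ≡ s ·I[mod t′ ] → A ≡ s ·I[mod t ]
  ≡·I[mod]-∣ {A} {s} {t} {t′} (q , qt≈t′) (Z , A≋) = q ⊙ Z , (begin
    A                    ≈⟨ A≋ ⟩
    s ⊙ I ⊕ t′ ⊙ Z       ≈⟨ ⊕-cong ≋-refl (⊙-congˡ Z (trans (sym qt≈t′) (*-comm q t))) ⟩
    s ⊙ I ⊕ (t · q) ⊙ Z  ≈⟨ ⊕-cong ≋-refl (⊙-assoc t q Z) ⟩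
    s ⊙ I ⊕ t ⊙ (q ⊙ Z)  ∎)

  ≡·I[mod]-refine : ∀ {A s t u Z W} → A ≋ s ⊙ I ⊕ t ⊙ Z → Z ≋ u ⊙ W → A ≡ s ·I[mod u · t ]
  ≡·I[mod]-refine {A} {s} {t} {u} {Z} {W} A≋ Z≋uW = W , (begin
    A                    ≈⟨ A≋ ⟩
    s ⊙ I ⊕ t ⊙ Z        ≈⟨ ⊕-cong ≋-refl (⊙-congʳ t Z≋uW) ⟩
    s ⊙ I ⊕ t ⊙ (u ⊙ W)  ≈⟨ ⊕-cong ≋-refl (⊙-assoc t u W) ⟨
    s ⊙ I ⊕ (t · u) ⊙ W  ≈⟨ ⊕-cong ≋-refl (⊙-congˡ W (*-comm t u)) ⟩
    s ⊙ I ⊕ (u · t) ⊙ W  ∎)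

  ≡·I[mod]⇒∣m₁₂ : ∀ {A s t} → A ≡ s ·I[mod t ] → t ∣ m12 A
  ≡·I[mod]⇒∣m₁₂ {s = s} {t} (Z , _ , A₁₂≈ , _) =
    m12 Z , trans (solve 3 (λ s t z → z :* t := s :* con (+ 0) :+ t :* z) refl s t (m12 Z)) (sym A₁₂≈)

  ≡·I[mod]⇔∣ : ∀ {A s t} → A ≡ s ·I[mod t ] ⇔ (t ∣ m11 A - s × t ∣ m12 A × t ∣ m21 A × t ∣ m22 A - s)
  ≡·I[mod]⇔∣ {A} {s} {t} = mk⇔
    (λ (Z , e₁₁ , e₁₂ , e₂₁ , e₂₂) → (m11 Z , diagonal⇒∣ e₁₁) , (m12 Z , offDiagonal⇒∣ e₁₂) ,
                                     (m21 Z , offDiagonal⇒∣ e₂₁) , (m22 Z , diagonal⇒∣ e₂₂))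
    (λ ((z₁₁ , d₁₁) , (z₁₂ , d₁₂) , (z₂₁ , d₂₁) , (z₂₂ , d₂₂)) →
      mat z₁₁ z₁₂ z₂₁ z₂₂ , ∣⇒diagonal d₁₁ , ∣⇒offDiagonal d₁₂ , ∣⇒offDiagonal d₂₁ , ∣⇒diagonal d₂₂)
    where
    diagonal⇒∣ : ∀ {x z} → x ≈ s · 1# + t · z → z · t ≈ x - s
    diagonal⇒∣ {x} {z} e = trans (solve 3 (λ s t z → z :* t := (s :* con (+ 1) :+ t :* z) :- s) refl s t z)
                                 (+-congʳ (sym e))
    offDiagonal⇒∣ : ∀ {x z} → x ≈ s · 0# + t · z → z · t ≈ x
    offDiagonal⇒∣ {x} {z} e = trans (solve 3 (λ s t z → z :* t := s :* con (+ 0) :+ t :* z) refl s t z) (sym e)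
    ∣⇒diagonal : ∀ {x z} → z · t ≈ x - s → x ≈ s · 1# + t · z
    ∣⇒diagonal {x} {z} d = trans (solve 2 (λ x s → x := s :* con (+ 1) :+ (x :- s)) refl x s)
                                 (+-congˡ (trans (sym d) (*-comm z t)))
    ∣⇒offDiagonal : ∀ {x z} → z · t ≈ x → x ≈ s · 0# + t · z
    ∣⇒offDiagonal {x} {z} d = trans (sym d) (solve 3 (λ s t z → z :* t := s :* con (+ 0) :+ t :* z) refl s t z)

module DiscreteValuationRing {c ℓ} (R : CommutativeRing c ℓ) (D : IsDVR R) where
  open CommutativeRing R renaming (_*_ to _·_)
  open IsDVR D
  open IsDomain isDomain
  open IntegerCoefficientSolver R
  open import Algebra.Properties.Semiring.Divisibility semiring
    using (_∣_; _,_; _∣0; ∣ʳ-trans; ∣ʳ-respʳ-≈)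
  open import Relation.Binary.Reasoning.Setoid setoid

  infixr 8 _^_
  _^_ : Carrier → ℕ → Carrier
  _^_ = pow R

  ^-homo-* : ∀ x m n → x ^ (m ℕ.+ n) ≈ x ^ m · x ^ n
  ^-homo-* x zero    n = sym (*-identityˡ _)
  ^-homo-* x (suc m) n = trans (*-congˡ (^-homo-* x m n)) (sym (*-assoc x _ _))

  x^[2k]≈x^k·x^k : ∀ x k → x ^ (2 * k) ≈ x ^ k · x ^ k
  x^[2k]≈x^k·x^k x k =
    trans (^-homo-* x k (k ℕ.+ 0)) (*-congˡ (reflexive (≡.cong (x ^_) (ℕ.+-identityʳ k))))

  x^m∣x^n : ∀ x {m n} → m ≤ n → x ^ m ∣ x ^ n
  x^m∣x^n x {m} m≤n with ℕ.m≤n⇒∃[o]m+o≡n m≤n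
  ... | o , ≡.refl = x ^ o , trans (*-comm _ _) (sym (^-homo-* x m o))

  x∣y∧x∣z⇒x∣y-z : ∀ {x y z} → x ∣ y → x ∣ z → x ∣ y - z
  x∣y∧x∣z⇒x∣y-z {x} (a , ax≈y) (b , bx≈z) =
    a - b , trans (solve 3 (λ a b x → (a :- b) :* x := a :* x :- b :* x) refl a b x) (+-cong ax≈y (-‿cong bx≈z))

  *-cancelʳ : ∀ {x y z} → ¬ z ≈ 0# → x · z ≈ y · z → x ≈ y
  *-cancelʳ {x} {y} {z} z≉0 xz≈yz with noZeroDiv (x - y) z (begin
    (x - y) · z    ≈⟨ solve 3 (λ x y z → (x :- y) :* z := x :* z :- y :* z) refl x y z ⟩
    x · z - y · z  ≈⟨ +-congʳ xz≈yz ⟩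
    y · z - y · z  ≈⟨ -‿inverseʳ (y · z) ⟩
    0#             ∎)
  ... | inj₁ x-y≈0 = trans (solve 2 (λ x y → x := (x :- y) :+ y) refl x y)
                           (trans (+-congʳ x-y≈0) (+-identityˡ y))
  ... | inj₂ z≈0   = ⊥-elim (z≉0 z≈0)

  π^n≉0 : ∀ n → ¬ π ^ n ≈ 0#
  π^n≉0 zero    = 1≉0
  π^n≉0 (suc n) ππⁿ≈0 with noZeroDiv π (π ^ n) ππⁿ≈0
  ... | inj₁ π≈0  = π≉0 π≈0
  ... | inj₂ πⁿ≈0 = π^n≉0 n πⁿ≈0

  unit-resp-≈ : ∀ {x y} → x ≈ y → IsUnit R x → IsUnit R y
  unit-resp-≈ x≈y (x⁻¹ , xx⁻¹≈1) = x⁻¹ , trans (*-congʳ (sym x≈y)) xx⁻¹≈1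

  unit-* : ∀ {x y} → IsUnit R x → IsUnit R y → IsUnit R (x · y)
  unit-* {x} {y} (x⁻¹ , xx⁻¹≈1) (y⁻¹ , yy⁻¹≈1) = x⁻¹ · y⁻¹ , (begin
    (x · y) · (x⁻¹ · y⁻¹)    ≈⟨ solve 4 (λ x y x⁻¹ y⁻¹ → (x :* y) :* (x⁻¹ :* y⁻¹) := (x :* x⁻¹) :* (y :* y⁻¹))
                                        refl x y x⁻¹ y⁻¹ ⟩
    (x · x⁻¹) · (y · y⁻¹)    ≈⟨ *-cong xx⁻¹≈1 yy⁻¹≈1 ⟩
    1# · 1#                  ≈⟨ *-identityˡ 1# ⟩
    1#                       ∎)

  unit-‿ : ∀ {x} → IsUnit R x → IsUnit R (- x)
  unit-‿ {x} (x⁻¹ , xx⁻¹≈1) = - x⁻¹ , trans (solve 2 (λ x y → (:- x) :* (:- y) := x :* y) refl x x⁻¹) xx⁻¹≈1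

  π∤unit : ∀ {u} → IsUnit R u → ¬ π ∣ u
  π∤unit {u} (u⁻¹ , uu⁻¹≈1) (q , qπ≈u) = π-nonunit (q · u⁻¹ , (begin
    π · (q · u⁻¹)  ≈⟨ solve 3 (λ p q u → p :* (q :* u) := (q :* p) :* u) refl π q u⁻¹ ⟩
    (q · π) · u⁻¹  ≈⟨ *-congʳ qπ≈u ⟩
    u · u⁻¹        ≈⟨ uu⁻¹≈1 ⟩
    1#             ∎))

  ≉0⇒unit⊎π∣ : ∀ {x} → ¬ x ≈ 0# → IsUnit R x ⊎ π ∣ x
  ≉0⇒unit⊎π∣ {x} x≉0 with v-spec x x≉0
  ... | u , u-unit , x≈uπᵛ = by-valuation (v x) x≈uπᵛ
    where
    by-valuation : ∀ n → x ≈ u · π ^ n → IsUnit R x ⊎ π ∣ x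
    by-valuation zero    x≈u·1    = inj₁ (unit-resp-≈ (sym (trans x≈u·1 (*-identityʳ u))) u-unit)
    by-valuation (suc n) x≈u·ππⁿ = inj₂ (u · π ^ n , trans
      (solve 3 (λ u p q → (u :* q) :* p := u :* (p :* q)) refl u π (π ^ n)) (sym x≈u·ππⁿ))

  unit+π∣ : ∀ {u x} → IsUnit R u → π ∣ x → IsUnit R (u + x)
  unit+π∣ {u} {x} u-unit π∣x = [ id , ⊥-elim ∘ π∤u+x ]′ (≉0⇒unit⊎π∣ u+x≉0)
    where
    π∤u+x : ¬ π ∣ u + x
    π∤u+x π∣u+x = π∤unit u-unit (∣ʳ-respʳ-≈ (solve 2 (λ u x → (u :+ x) :- x := u) refl u x)
                                             (x∣y∧x∣z⇒x∣y-z π∣u+x π∣x))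
    u+x≉0 : ¬ u + x ≈ 0#
    u+x≉0 u+x≈0 = π∤u+x (∣ʳ-respʳ-≈ (sym u+x≈0) (π ∣0))

  -- The valuation of x is only meaningful when x ≉ 0, which is undecidable; but x + π ^ suc (v x) is never 0.
  x+π^[1+v]≉0 : ∀ x → ¬ x + π ^ suc (v x) ≈ 0#
  x+π^[1+v]≉0 x y≈0 = π∤valuation-unit (v-spec x x≉0)
    where
    n : ℕ
    n = v x
    x≈-ππⁿ : x ≈ (- π) · π ^ n
    x≈-ππⁿ = begin
      x                            ≈⟨ solve 2 (λ x q → x := (x :+ q) :- q) refl x (π ^ suc n) ⟩
      (x + π ^ suc n) - π ^ suc n  ≈⟨ +-congʳ y≈0 ⟩
      0# - π · π ^ n               ≈⟨ solve 2 (λ p q → con (+ 0) :- p :* q := (:- p) :* q) refl π (π ^ n) ⟩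
      (- π) · π ^ n                ∎
    x≉0 : ¬ x ≈ 0#
    x≉0 x≈0 = π^n≉0 (suc n) (begin
      π ^ suc n                    ≈⟨ solve 2 (λ x q → q := (x :+ q) :- x) refl x (π ^ suc n) ⟩
      (x + π ^ suc n) - x          ≈⟨ +-cong y≈0 (-‿cong x≈0) ⟩
      0# - 0#                      ≈⟨ -‿inverseʳ 0# ⟩
      0#                           ∎)
    π∤valuation-unit : ¬ (∃[ u ] (IsUnit R u × x ≈ u · π ^ n))
    π∤valuation-unit (u , u-unit , x≈uπⁿ) = π∤unit u-unit (- 1# , (begin
      - 1# · π  ≈⟨ solve 1 (λ p → (:- con (+ 1)) :* p := :- p) refl π ⟩
      - π       ≈⟨ *-cancelʳ (π^n≉0 n) (trans (sym x≈-ππⁿ) x≈uπⁿ) ⟩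
      u         ∎))

  unit⊎π∣ : ∀ x → IsUnit R x ⊎ π ∣ x
  unit⊎π∣ x = Sum.map
    (λ y-unit → unit-resp-≈ y-πⁿ⁺¹≈x (unit+π∣ y-unit (- π ^ n , -πⁿ·π≈-πⁿ⁺¹)))
    (λ π∣y → ∣ʳ-respʳ-≈ y-πⁿ⁺¹≈x (x∣y∧x∣z⇒x∣y-z π∣y (π ^ n , *-comm (π ^ n) π)))
    (≉0⇒unit⊎π∣ (x+π^[1+v]≉0 x))
    where
    n : ℕ
    n = v x
    -πⁿ·π≈-πⁿ⁺¹ : - π ^ n · π ≈ - π ^ suc n
    -πⁿ·π≈-πⁿ⁺¹ = solve 2 (λ p q → (:- q) :* p := :- (p :* q)) refl π (π ^ n)
    y-πⁿ⁺¹≈x : (x + π ^ suc n) - π ^ suc n ≈ x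
    y-πⁿ⁺¹≈x = solve 2 (λ x q → (x :+ q) :- q := x) refl x (π ^ suc n)

  π^_∣?_ : ∀ j x → Dec (π ^ j ∣ x)
  π^ zero  ∣? x = yes (x , *-identityʳ x)
  π^ suc j ∣? x = extend (π^ j ∣? x)
    where
    extend : Dec (π ^ j ∣ x) → Dec (π ^ suc j ∣ x)
    extend (no π^j∤x)        = no (π^j∤x ∘ ∣ʳ-trans (π , refl))
    extend (yes (q , qπʲ≈x)) = [ no ∘ π^j⁺¹∤x , yes ∘ π^j⁺¹∣x ]′ (unit⊎π∣ q)
      where
      π^j⁺¹∣x : π ∣ q → π ^ suc j ∣ x
      π^j⁺¹∣x (r , rπ≈q) = r , (begin
        r · π ^ suc j    ≈⟨ *-assoc r π (π ^ j) ⟨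
        (r · π) · π ^ j  ≈⟨ *-congʳ rπ≈q ⟩
        q · π ^ j        ≈⟨ qπʲ≈x ⟩
        x                ∎)
      π^j⁺¹∤x : IsUnit R q → ¬ π ^ suc j ∣ x
      π^j⁺¹∤x q-unit (r , rπʲ⁺¹≈x) = π∤unit q-unit (r , *-cancelʳ (π^n≉0 j) (begin
        (r · π) · π ^ j  ≈⟨ *-assoc r π (π ^ j) ⟩
        r · π ^ suc j    ≈⟨ rπʲ⁺¹≈x ⟩
        x                ≈⟨ qπʲ≈x ⟨
        q · π ^ j        ∎))

  π^m∣uπ^n⇒m≤n : ∀ {u} m n → IsUnit R u → π ^ m ∣ u · π ^ n → m ≤ n
  π^m∣uπ^n⇒m≤n zero    n       u-unit _ = ℕ.z≤n
  π^m∣uπ^n⇒m≤n {u} (suc m) zero    u-unit (q , qπᵐ⁺¹≈u) = ⊥-elim (π∤unit u-unit (q · π ^ m , (begin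
    (q · π ^ m) · π  ≈⟨ solve 3 (λ q p r → (q :* r) :* p := q :* (p :* r)) refl q π (π ^ m) ⟩
    q · π ^ suc m    ≈⟨ qπᵐ⁺¹≈u ⟩
    u · 1#           ≈⟨ *-identityʳ u ⟩
    u                ∎)))
  π^m∣uπ^n⇒m≤n {u} (suc m) (suc n) u-unit (q , qπᵐ⁺¹≈uπⁿ⁺¹) =
    ℕ.s≤s (π^m∣uπ^n⇒m≤n m n u-unit (q , *-cancelʳ π≉0 (begin
      (q · π ^ m) · π    ≈⟨ solve 3 (λ q p r → (q :* r) :* p := q :* (p :* r)) refl q π (π ^ m) ⟩
      q · π ^ suc m      ≈⟨ qπᵐ⁺¹≈uπⁿ⁺¹ ⟩
      u · π ^ suc n      ≈⟨ solve 3 (λ u p r → u :* (p :* r) := (u :* r) :* p) refl u π (π ^ n) ⟩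
      (u · π ^ n) · π    ∎)))

  π^k·π^k∣x⇒2k≤v : ∀ {x} k → ¬ x ≈ 0# → π ^ k · π ^ k ∣ x → 2 * k ≤ v x
  π^k·π^k∣x⇒2k≤v {x} k x≉0 (q , qπᵏπᵏ≈x) with v-spec x x≉0
  ... | u , u-unit , x≈uπᵛ =
    π^m∣uπ^n⇒m≤n (2 * k) (v x) u-unit (q , trans (*-congˡ (x^[2k]≈x^k·x^k π k)) (trans qπᵏπᵏ≈x x≈uπᵛ))

  2k≤v⇒π^k∣x/π^k : ∀ {x y} k → ¬ x ≈ 0# → 2 * k ≤ v x → y · π ^ k ≈ x → π ^ k ∣ y
  2k≤v⇒π^k∣x/π^k {x} {y} k x≉0 2k≤v yπᵏ≈x with v-spec x x≉0 | ℕ.m≤n⇒∃[o]m+o≡n 2k≤v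
  ... | u , u-unit , x≈uπᵛ | o , 2k+o≡v = u · π ^ o , *-cancelʳ (π^n≉0 k) (begin
    ((u · π ^ o) · π ^ k) · π ^ k  ≈⟨ solve 3 (λ u a b → ((u :* a) :* b) :* b := u :* ((b :* b) :* a))
                                              refl u (π ^ o) (π ^ k) ⟩
    u · ((π ^ k · π ^ k) · π ^ o)  ≈⟨ *-congˡ (*-congʳ (x^[2k]≈x^k·x^k π k)) ⟨
    u · (π ^ (2 * k) · π ^ o)      ≈⟨ *-congˡ (^-homo-* π (2 * k) o) ⟨
    u · π ^ (2 * k ℕ.+ o)          ≡⟨ ≡.cong (λ n → u · π ^ n) 2k+o≡v ⟩
    u · π ^ v x                    ≈⟨ x≈uπᵛ ⟨
    x                              ≈⟨ yπᵏ≈x ⟨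
    y · π ^ k                      ∎)

  π^m∣π^n⇒m≤n : ∀ m n → π ^ m ∣ π ^ n → m ≤ n
  π^m∣π^n⇒m≤n m n π^m∣π^n =
    π^m∣uπ^n⇒m≤n m n (1# , *-identityˡ 1#) (∣ʳ-respʳ-≈ (sym (*-identityˡ _)) π^m∣π^n)

  open Matrix R using (det; cyclicBasis)

  ∃-unimodular-cyclicBasis : ∀ {p q r} → IsUnit R (1# + 1#) → ¬ (π ∣ p × π ∣ q × π ∣ r) →
    ∃[ α ] ∃[ β ] IsUnit R (det (cyclicBasis p q r α β))
  ∃-unimodular-cyclicBasis {p} {q} {r} 2-unit π∤pqr =
    [ (λ q-unit → 0# , 1# , unit-resp-≈ det₀₁ q-unit) , (λ π∣q →
    [ (λ r-unit → 1# , 0# , unit-resp-≈ det₁₀ (unit-‿ r-unit)) , (λ π∣r →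
    [ (λ p-unit → 1# , 1# , unit-resp-≈ det₁₁ (unit+π∣ (unit-* 2-unit p-unit) (x∣y∧x∣z⇒x∣y-z π∣q π∣r))) ,
      (λ π∣p → ⊥-elim (π∤pqr (π∣p , π∣q , π∣r))) ]′ (unit⊎π∣ p)) ]′ (unit⊎π∣ r)) ]′ (unit⊎π∣ q)
    where
    det₀₁ : q ≈ det (cyclicBasis p q r 0# 1#)
    det₀₁ = solve 3 (λ p q r → q
                            := (p :* con (+ 0) :+ q :* con (+ 1)) :* con (+ 1)
                               :- con (+ 0) :* (r :* con (+ 0) :- p :* con (+ 1))) refl p q r
    det₁₀ : - r ≈ det (cyclicBasis p q r 1# 0#)
    det₁₀ = solve 3 (λ p q r → :- r
                            := (p :* con (+ 1) :+ q :* con (+ 0)) :* con (+ 0)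
                               :- con (+ 1) :* (r :* con (+ 1) :- p :* con (+ 0))) refl p q r
    det₁₁ : (1# + 1#) · p + (q - r) ≈ det (cyclicBasis p q r 1# 1#)
    det₁₁ = solve 3 (λ p q r → (con (+ 1) :+ con (+ 1)) :* p :+ (q :- r)
                            := (p :* con (+ 1) :+ q :* con (+ 1)) :* con (+ 1)
                               :- con (+ 1) :* (r :* con (+ 1) :- p :* con (+ 1))) refl p q r

module NormalForm {c ℓ} (R : CommutativeRing c ℓ) (D : IsDVR R) where
  open CommutativeRing R renaming (_*_ to _·_)
  open IsDVR D
  open IntegerCoefficientSolver R
  open Matrix R
  open DiscreteValuationRing R D
  open import Algebra.Properties.Semiring.Divisibility semiring using (_∣_; _,_; _∣0; 1∣_; ∣ʳ-respʳ-≈)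
  open import Relation.Binary.Reasoning.Setoid setoid

  module Quadratic (half : Carrier) (half·2≈1 : half · (1# + 1#) ≈ 1#) (a b : Carrier)
                   (irreducible : Irreducible₂ R a b) where

    s : Carrier
    s = a · half

    Δ : Carrier
    Δ = a · a · half · half + b

    normalForm : ℕ → Carrier → Mat2 R
    normalForm = NF R half a π

    a≈s+s : a ≈ s + s
    a≈s+s = begin
      a                       ≈⟨ *-identityʳ a ⟨
      a · 1#                  ≈⟨ *-congˡ half·2≈1 ⟨
      a · (half · (1# + 1#))  ≈⟨ solve 2 (λ a h → a :* (h :* (con (+ 1) :+ con (+ 1))) := a :* h :+ a :* h)
                                         refl a half ⟩
      s + s                   ∎

    -- Otherwise f = (x - s)².
    Δ≉0 : ¬ Δ ≈ 0#
    Δ≉0 Δ≈0 = irreducible (inj₁ (1# , - s , 1# , - s , *-identityˡ 1# , linear , constant))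
      where
      linear : 1# · - s + - s · 1# ≈ - a
      linear = trans (solve 1 (λ s → con (+ 1) :* (:- s) :+ (:- s) :* con (+ 1) := :- (s :+ s)) refl s)
                     (-‿cong (sym a≈s+s))
      constant : - s · - s ≈ - b
      constant = begin
        - s · - s  ≈⟨ solve 3 (λ a h b → (:- (a :* h)) :* (:- (a :* h)) := (a :* a :* h :* h :+ b) :- b)
                             refl a half b ⟩
        Δ - b      ≈⟨ +-congʳ Δ≈0 ⟩
        0# - b     ≈⟨ +-identityˡ (- b) ⟩
        - b        ∎

    Δ≈[m₁₁-s]²+m₁₂m₂₁ : ∀ {A} → HasCharPoly R A a b → Δ ≈ (m11 A - s) · (m11 A - s) + m12 A · m21 A
    Δ≈[m₁₁-s]²+m₁₂m₂₁ {mat x y z w} (trace , determinant) = begin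
      Δ                                            ≈⟨ Δ≈s²+b ⟩
      s · s + b                                    ≈⟨ s²+b≈ ⟩
      (x - s) · (x - s) + (x · ((s + s) - x) + b)  ≈⟨ +-congˡ (+-congʳ (*-congˡ w≈2s-x)) ⟨
      (x - s) · (x - s) + (x · w + b)              ≈⟨ +-congˡ yz≈xw+b ⟨
      (x - s) · (x - s) + y · z                    ∎
      where
      Δ≈s²+b : Δ ≈ s · s + b
      Δ≈s²+b = solve 3 (λ a h b → a :* a :* h :* h :+ b := (a :* h) :* (a :* h) :+ b) refl a half b
      s²+b≈ : s · s + b ≈ (x - s) · (x - s) + (x · ((s + s) - x) + b)
      s²+b≈ = solve 3 (λ x s b → s :* s :+ b := (x :- s) :* (x :- s) :+ (x :* ((s :+ s) :- x) :+ b)) refl x s b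
      w≈2s-x : w ≈ (s + s) - x
      w≈2s-x = trans (solve 2 (λ x w → w := (x :+ w) :- x) refl x w) (+-congʳ (trans trace a≈s+s))
      yz≈xw+b : y · z ≈ x · w + b
      yz≈xw+b = trans (solve 2 (λ d e → e := d :- (d :- e)) refl (x · w) (y · z))
                      (+-congˡ (trans (-‿cong determinant) (solve 1 (λ b → :- (:- b) := b) refl b)))

    Δ≈[z₁₁²+z₁₂z₂₁]t² : ∀ {A t Z} → HasCharPoly R A a b → A ≋ s ⊙ I ⊕ t ⊙ Z →
      Δ ≈ (m11 Z · m11 Z + m12 Z · m21 Z) · (t · t)
    Δ≈[z₁₁²+z₁₂z₂₁]t² {A} {t} {mat z₁₁ z₁₂ z₂₁ z₂₂} χ (e₁₁ , e₁₂ , e₂₁ , _) = begin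
      Δ                                                ≈⟨ Δ≈[m₁₁-s]²+m₁₂m₂₁ χ ⟩
      (m11 A - s) · (m11 A - s) + m12 A · m21 A        ≈⟨ +-cong (*-cong (+-congʳ e₁₁) (+-congʳ e₁₁))
                                                                  (*-cong e₁₂ e₂₁) ⟩
      (s · 1# + t · z₁₁ - s) · (s · 1# + t · z₁₁ - s)
        + (s · 0# + t · z₁₂) · (s · 0# + t · z₂₁)      ≈⟨ solve 5 (λ s t z₁₁ z₁₂ z₂₁ →
          (s :* con (+ 1) :+ t :* z₁₁ :- s) :* (s :* con (+ 1) :+ t :* z₁₁ :- s)
            :+ (s :* con (+ 0) :+ t :* z₁₂) :* (s :* con (+ 0) :+ t :* z₂₁)
          := (z₁₁ :* z₁₁ :+ z₁₂ :* z₂₁) :* (t :* t)) refl s t z₁₁ z₁₂ z₂₁ ⟩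
      (z₁₁ · z₁₁ + z₁₂ · z₂₁) · (t · t)                ∎

    ≡·I[mod]⇒2k≤vΔ : ∀ {A} k → HasCharPoly R A a b → A ≡ s ·I[mod π ^ k ] → 2 * k ≤ v Δ
    ≡·I[mod]⇒2k≤vΔ k χ (Z , A≋) = π^k·π^k∣x⇒2k≤v k Δ≉0 (_ , sym (Δ≈[z₁₁²+z₁₂z₂₁]t² χ A≋))

    traceless-cofactor : ∀ {A t Z} → HasCharPoly R A a b → A ≋ s ⊙ I ⊕ t ⊙ Z → ¬ t ≈ 0# →
      Z ≋ traceless (m11 Z) (m12 Z) (m21 Z)
    traceless-cofactor {A} {t} {mat z₁₁ z₁₂ z₂₁ z₂₂} (trace , _) (e₁₁ , _ , _ , e₂₂) t≉0 =
      refl , refl , refl , z₂₂≈-z₁₁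
      where
      [z₁₁+z₂₂]t≈0·t : (z₁₁ + z₂₂) · t ≈ 0# · t
      [z₁₁+z₂₂]t≈0·t = begin
        (z₁₁ + z₂₂) · t                                      ≈⟨ solve 4 (λ s t z₁₁ z₂₂ → (z₁₁ :+ z₂₂) :* t
          := ((s :* con (+ 1) :+ t :* z₁₁) :+ (s :* con (+ 1) :+ t :* z₂₂)) :- (s :+ s)) refl s t z₁₁ z₂₂ ⟩
        ((s · 1# + t · z₁₁) + (s · 1# + t · z₂₂)) - (s + s)  ≈⟨ +-cong (+-cong e₁₁ e₂₂) (-‿cong a≈s+s) ⟨
        (m11 A + m22 A) - a                                  ≈⟨ +-congʳ trace ⟩
        a - a                                                ≈⟨ -‿inverseʳ a ⟩
        0#                                                   ≈⟨ zeroˡ t ⟨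
        0# · t                                               ∎
      z₂₂≈-z₁₁ : z₂₂ ≈ - z₁₁
      z₂₂≈-z₁₁ = trans (solve 2 (λ x y → y := (x :+ y) :- x) refl z₁₁ z₂₂)
                       (trans (+-congʳ (*-cancelʳ t≉0 [z₁₁+z₂₂]t≈0·t)) (+-identityˡ (- z₁₁)))

    record Depth (A : Mat2 R) (k : ℕ) : Set (c ⊔ ℓ) where
      constructor depth
      field
        ≡·I[mod]π^k      : A ≡ s ·I[mod π ^ k ]
        ¬≡·I[mod]π^[1+k] : ¬ A ≡ s ·I[mod π ^ suc k ]

    ∃-depth : ∀ {A} → HasCharPoly R A a b → ∃[ k ] Depth A k
    ∃-depth {A} χ =
      let (k , ≡·I[mod]π^k , ¬≡·I[mod]π^[1+k]) =
            ∃-boundary ≡·I[mod]? ≡·I[mod]1 (suc (v Δ)) ¬≡·I[mod]π^[1+vΔ]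
      in k , depth ≡·I[mod]π^k ¬≡·I[mod]π^[1+k]
      where
      ≡·I[mod]? : ∀ j → Dec (A ≡ s ·I[mod π ^ j ])
      ≡·I[mod]? j = Dec.map′ (Equivalence.from ≡·I[mod]⇔∣) (Equivalence.to ≡·I[mod]⇔∣)
        (π^ j ∣? (m11 A - s) ×-dec π^ j ∣? m12 A ×-dec π^ j ∣? m21 A ×-dec π^ j ∣? (m22 A - s))
      ≡·I[mod]1 : A ≡ s ·I[mod 1# ]
      ≡·I[mod]1 = Equivalence.from ≡·I[mod]⇔∣ ((1∣ _) , (1∣ _) , (1∣ _) , (1∣ _))
      ¬≡·I[mod]π^[1+vΔ] : ¬ A ≡ s ·I[mod π ^ suc (v Δ) ]
      ¬≡·I[mod]π^[1+vΔ] ≡·I = ℕ.<-irrefl ≡.refl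
        (ℕ.≤-trans (ℕ.m≤m+n (suc (v Δ)) _) (≡·I[mod]⇒2k≤vΔ (suc (v Δ)) χ ≡·I))

    depth-max : ∀ {A j k} → Depth A k → A ≡ s ·I[mod π ^ j ] → j ≤ k
    depth-max (depth _ ¬≡·I[mod]π^[1+k]) ≡·I[mod]π^j =
      ℕ.≮⇒≥ (λ k<j → ¬≡·I[mod]π^[1+k] (≡·I[mod]-∣ (x^m∣x^n π k<j) ≡·I[mod]π^j))

    normalForm-≡·I[mod] : ∀ k {y} → 2 * k ≤ v Δ → y · π ^ k ≈ Δ → normalForm k y ≡ s ·I[mod π ^ k ]
    normalForm-≡·I[mod] k 2k≤vΔ yπᵏ≈Δ = Equivalence.from ≡·I[mod]⇔∣
      (π^k∣s-s , (1# , *-identityˡ _) , 2k≤v⇒π^k∣x/π^k k Δ≉0 2k≤vΔ yπᵏ≈Δ , π^k∣s-s)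
      where
      π^k∣s-s : π ^ k ∣ s - s
      π^k∣s-s = ∣ʳ-respʳ-≈ (sym (-‿inverseʳ s)) ((π ^ k) ∣0)

    similar-to-normalForm : ∀ {A k} → HasCharPoly R A a b → Depth A k →
      ∃[ y ] (y · π ^ k ≈ Δ × Similar R A (normalForm k y))
    similar-to-normalForm {A} {k} χ (depth (Z , A≋) ¬≡·I[mod]π^[1+k]) =
      t · d , yt≈Δ , conjugate (∃-unimodular-cyclicBasis 2-unit π∤pqr)
      where
      t p q r d : Carrier
      t = π ^ k
      p = m11 Z
      q = m12 Z
      r = m21 Z
      d = p · p + q · r
      Z≋N : Z ≋ traceless p q r
      Z≋N = traceless-cofactor χ A≋ (π^n≉0 k)
      2-unit : IsUnit R (1# + 1#)
      2-unit = half , trans (*-comm _ _) half·2≈1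
      yt≈Δ : (t · d) · t ≈ Δ
      yt≈Δ = trans (solve 2 (λ t d → (t :* d) :* t := d :* (t :* t)) refl t d) (sym (Δ≈[z₁₁²+z₁₂z₂₁]t² χ A≋))
      π∤pqr : ¬ (π ∣ p × π ∣ q × π ∣ r)
      π∤pqr ((p′ , p′π≈p) , (q′ , q′π≈q) , (r′ , r′π≈r)) =
        ¬≡·I[mod]π^[1+k] (≡·I[mod]-refine A≋ (≋-trans Z≋N N≋πN′))
        where
        N≋πN′ : traceless p q r ≋ π ⊙ traceless p′ q′ r′
        N≋πN′ = trans (sym p′π≈p) (*-comm p′ π) , trans (sym q′π≈q) (*-comm q′ π) ,
                trans (sym r′π≈r) (*-comm r′ π) ,
                trans (-‿cong (sym p′π≈p)) (solve 2 (λ x p → :- (x :* p) := p :* (:- x)) refl p′ π)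
      conjugate : ∃[ α ] ∃[ β ] IsUnit R (det (cyclicBasis p q r α β)) → Similar R A (normalForm k (t · d))
      conjugate (α , β , e , det·e≈1) = similar-resp-≋
        (≋-trans A≋ (⊕-cong ≋-refl (⊙-congʳ t Z≋N))) (affine-companion s t d) (similar-companion s t det·e≈1)

    normalForm-unique : ∀ {A k y} → Depth A k → y · π ^ k ≈ Δ →
      ∀ k′ y′ → 2 * k′ ≤ v Δ → y′ · π ^ k′ ≈ Δ → Similar R A (normalForm k′ y′) →
      normalForm k′ y′ ≋ normalForm k y
    normalForm-unique {A} {k} {y} depth-k yπᵏ≈Δ k′ y′ 2k′≤vΔ y′πᵏ′≈Δ A∼N′ = same-depth (ℕ.≤-antisym k′≤k k≤k′)
      where
      k′≤k : k′ ≤ k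
      k′≤k = depth-max depth-k (≡·I[mod]-similar (similar-sym A∼N′) (normalForm-≡·I[mod] k′ 2k′≤vΔ y′πᵏ′≈Δ))
      k≤k′ : k ≤ k′
      k≤k′ = π^m∣π^n⇒m≤n k k′ (≡·I[mod]⇒∣m₁₂ (≡·I[mod]-similar A∼N′ (Depth.≡·I[mod]π^k depth-k)))
      same-depth : k′ ≡ k → normalForm k′ y′ ≋ normalForm k y
      same-depth ≡.refl = refl , refl , *-cancelʳ (π^n≉0 k) (trans y′πᵏ′≈Δ (sym yπᵏ≈Δ)) , refl

proposition17 : ∀ {c ℓ} (R : CommutativeRing c ℓ) (D : IsDVR R)
    → let open CommutativeRing R renaming (_*_ to _·_)
          open IsDVR D
      in (half : Carrier) → half · (1# + 1#) ≈ 1#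
      → (a b : Carrier) → Irreducible₂ R a b
      → let Δ = a · a · half · half + b
        in (A : Mat2 R) → HasCharPoly R A a b
        → ∃[ k ] ∃[ y ] ((2 * k ≤ v Δ) × (y · pow R π k ≈ Δ)
             × Similar R A (NF R half a π k y)
             × (∀ k′ y′ → 2 * k′ ≤ v Δ → y′ · pow R π k′ ≈ Δ
                  → Similar R A (NF R half a π k′ y′)
                  → _≈M_ R (NF R half a π k′ y′) (NF R half a π k y)))
proposition17 R D half half·2≈1 a b irreducible A χ =
  let open NormalForm.Quadratic R D half half·2≈1 a b irreducible
      (k , depth-k) = ∃-depth χ
      (y , yπᵏ≈Δ , A∼N) = similar-to-normalForm χ depth-k
  in k , y , ≡·I[mod]⇒2k≤vΔ k χ (Depth.≡·I[mod]π^k depth-k) , yπᵏ≈Δ , A∼N , normalForm-unique depth-k yπᵏ≈Δ
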